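{- (Consistency.) Let $L=(V,F,C,\#)$ be a language in which $F$ contains the negation symbol $\neg$, with $A_\neg(x_1)$ true for every single object $x_1$, $A_\neg$ false on sequences of other lengths, and $P_\neg(x_1)=$ "$x_1$ is false". Let $D=(L,\mathcal A,\mathcal R)$ be a deductive system. Then there is no sentence $\varphi\in S(\varepsilon)$ such that both $\varphi$ and $(\neg)(\varphi)$ have proofs in $D$.
   Context: A language $L=(V,F,C,\#)$ consists of: a set $V$ of variables; a set $C$ of constants, each $c\in C$ having a meaning $\#(c)$; a set $F$ of operator symbols, each $f\in F$ with an applicability condition $A_f(x_1,\dots,x_n)$ on finite sequences of objects and, whenever it holds, a value $P_f(x_1,\dots,x_n)$; auxiliary symbols $($, $)$, $,$, $:$, $\{\}$ (one symbol). All pairwise disjoint, uniquely readable; expressions are strings written by juxtaposition. A soop is a finite sequence of ordered pairs; $\varepsilon$ empty, $\|$ concatenation, a pair identified with a one-term soop; $\mathrm{dom}$ of a soop is the set of first components, $\alpha(a_i)=b_i$ when first components are distinct; $\alpha\sqsubseteq\gamma$ means $\alpha$ is an initial segment of $\gamma$. Simultaneous induction on $n\ge1$ defines contexts $K(n)$, states $\Xi(k)$, expressions $E(n,k)$, meanings $\#(k,t,\sigma)$, and $V_b(t),V_f(t)$: $K(1)=\{\varepsilon\}$, $\Xi(\varepsilon)=\{\varepsilon\}$, $E(1,\varepsilon)=C$, $\#(\varepsilon,c,\varepsilon)=\#(c)$, $V_b(c)=V_f(c)=\emptyset$. $K(n)^+$ = all $h\|(y,\varphi)$ with $h\in K(n)$,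 $\varphi\in E(n,h)$, $y\in V\setminus\mathrm{dom}(h)$, $\#(h,\varphi,\rho)$ a set for all $\rho\in\Xi(h)$; $K(n+1)=K(n)\cup K(n)^+$; for $k=h\|(y,\varphi)\in K(n)^+$, $\Xi(k)=\{\rho\|(y,s):\rho\in\Xi(h),s\in\#(h,\varphi,\rho)\}$. $E(n+1,k)$ is the union of: (0) $E(n,k)$ if $k\in K(n)$; (a) for $k=h\|(y,\varphi)\in K(n)^+$, all $t\in E(n,h)$ with $y\notin V_b(t)$, $\#(k,t,\rho\|(y,s))=\#(h,t,\rho)$; (b) for such $k$, the expression $y$ with $\#(k,y,\sigma)=\sigma(y)$, $V_f(y)=\{y\}$, $V_b(y)=\emptyset$; (c) for $k\in K(n)$, $(\varphi)(\varphi_1,\dots,\varphi_m)$ with $\varphi,\varphi_i\in E(n,k)$ and $\#(k,\varphi,\sigma)$ an $m$-argument function defined at $(\#(k,\varphi_1,\sigma),\dots)$ for all $\sigma$, meaning its value there, $V_b,V_f$ unions; (d) for $k\in K(n)$, $(f)(\varphi_1,\dots,\varphi_m)$, $f\in F$, $\varphi_i\in E(n,k)$, $A_f(\#(k,\varphi_1,\sigma),\dots)$ for all $\sigma$, meaning $P_f(\dots)$, $V_b,V_f$ unions; (e) for $k\in K(n)$, $\{\}(x_1:\varphi_1,\dots,x_m:\varphi_m,\varphi)$ with $x_i$ distinct in $V\setminus\mathrm{dom}(k)$, $k'_i=k\|(x_1,\varphi_1)\|\dots\|(x_i,\varphi_i)\in K(n)$, $\varphi_i\in E(n,k'_{i-1})$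 with set meanings, $\varphi\in E(n,k'_m)$; meaning $\{\#(k'_m,\varphi,\sigma'):\sigma'\in\Xi(k'_m),\sigma\sqsubseteq\sigma'\}$, $V_b=\{x_1,\dots,x_m\}\cup\bigcup V_b(\varphi_i)\cup V_b(\varphi)$, $V_f=V_f(\varphi_1)\cup(V_f(\varphi_2)\setminus\{x_1\})\cup\dots\cup(V_f(\varphi)\setminus\{x_1,\dots,x_m\})$. $K=\bigcup K(n)$, $E(k)=\bigcup_{n}E(n,k)$. $S(k)$: $t\in E(k)$ with $\#(k,t,\sigma)$ true or false for all $\sigma\in\Xi(k)$; $\#(t)=\#(\varepsilon,t,\varepsilon)$; sentences are elements of $S(\varepsilon)$. An axiom is a set $A\subseteq S(\varepsilon)$ with $\#(\varphi)$ true for all $\varphi\in A$. An $n$-ary rule is $R\subseteq S(\varepsilon)^{n+1}$ such that for all $(\varphi_1,\dots,\varphi_n,\varphi)\in R$, if all $\#(\varphi_i)$ are true then $\#(\varphi)$ is true. A deductive system is $(L,\mathcal A,\mathcal R)$ with $\mathcal A$ a set of axioms, $\mathcal R$ a set of rules. A proof of $\varphi$ is a sequence of sentences $(\psi_1,\dots,\psi_m)$, $\psi_1$ in some axiom, each later $\psi_j$ in some axiom or with $(\psi_{i_1},\dots,\psi_{i_n},\psi_j)\in R$ for some $n$-ary $R\in\mathcal R$ and $i_1,\dots,i_n<j$, and $\psi_m=\varphi$. -}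

module Defs where

open import Level using (Level) renaming (suc to lsuc)
open import Data.Nat using (ℕ; zero; suc)
open import Data.Fin using (Fin; zero; suc; fromℕ; toℕ)
open import Data.List using (List; []; _∷_; tabulate)
open import Data.Maybe using (Maybe; just)
open import Data.Product using (Σ; _×_; _,_; proj₁; proj₂)
open import Data.Sum using (_⊎_)
open import Data.Unit.Polymorphic using (⊤)
open import Data.Empty.Polymorphic using (⊥)
open import Relation.Binary.PropositionalEquality using (_≡_; _≢_)
import Data.Nat as ℕ

-- The ambient universe of "objects" (the paper's set-theoretic meta
-- theory).  Objects may be truth values (propositions), sets, and
-- functions.  Propositions are objects via ⌜_⌝.

record Universe (ℓ : Level) : Set (lsuc (lsuc ℓ)) where
  field
    Obj     : Set (lsuc ℓ)
    IsTrue  : Obj → Set ℓ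
    IsFalse : Obj → Set ℓ
    true-not-false : ∀ x → IsTrue x → IsFalse x → ⊥ {lsuc ℓ}
    ⌜_⌝      : Set ℓ → Obj
    ⌜⌝-true  : ∀ (P : Set ℓ) → (IsTrue ⌜ P ⌝ → P) × (P → IsTrue ⌜ P ⌝)
    ⌜⌝-false : ∀ (P : Set ℓ) → (IsFalse ⌜ P ⌝ → (P → ⊥ {ℓ})) × ((P → ⊥ {ℓ}) → IsFalse ⌜ P ⌝)
    -- sets: a set object has its elements given by a (small) family
    members : Obj → Maybe (Σ (Set ℓ) λ I → (I → Obj))
    collect : (I : Set ℓ) → (I → Obj) → Obj
    collect-members : ∀ I f → members (collect I f) ≡ just (I , f)
    -- "f is a (length xs)-argument function defined at xs", and its value
    IsFunAt : Obj → List Obj → Set (lsuc ℓ)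
    apply   : (f : Obj) (xs : List Obj) → IsFunAt f xs → Obj

record Language {ℓ : Level} (U : Universe ℓ) : Set (lsuc (lsuc ℓ)) where
  open Universe U
  field
    V  : Set ℓ
    C  : Set ℓ
    F  : Set ℓ
    #c : C → Obj
    A  : F → List Obj → Set (lsuc ℓ)
    P  : (f : F) (xs : List Obj) → A f xs → Obj

-- Contexts, states, expressions, meanings, bound/free variables
-- (simultaneous inductive-recursive definition; the stratification by n
-- of the paper is only there to make the definition well founded)

module Syntax {ℓ : Level} (U : Universe ℓ) (L : Language U) where
  open Universe U
  open Language L

  IsSet : Obj → Set (lsuc ℓ)
  IsSet x = Σ (Σ (Set ℓ) λ I → (I → Obj)) λ m → members x ≡ just m

  data Ctx : Set (lsuc ℓ)
  State : Ctx → Set ℓ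
  _∈dom_ : V → Ctx → Set ℓ
  data Expr : Ctx → Set (lsuc ℓ)
  ⟦_⟧ : ∀ {k} → Expr k → State k → Obj
  Vb : ∀ {k} → Expr k → V → Set ℓ
  Vf : ∀ {k} → Expr k → V → Set ℓ
  data Tel : Ctx → Set (lsuc ℓ)
  _⊕_ : (k : Ctx) → Tel k → Ctx
  NonEmpty : ∀ {k} → Tel k → Set
  Ext : ∀ {k} (t : Tel k) → State k → Set ℓ
  extend : ∀ {k} (t : Tel k) (σ : State k) → Ext t σ → State (k ⊕ t)
  binders : ∀ {k} → Tel k → V → Set ℓ
  TelVb : ∀ {k} → Tel k → V → Set ℓ
  TelVf : ∀ {k} → Tel k → V → Set ℓ

  data Ctx where
    ε : Ctx
    _▷_∶_[_,_] : (h : Ctx) (y : V) (φ : Expr h) →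
                 ((y ∈dom h) → ⊥ {ℓ}) → (∀ ρ → IsSet (⟦ φ ⟧ ρ)) → Ctx

  State ε = ⊤
  State (h ▷ y ∶ φ [ fr , s ]) = Σ (State h) λ ρ → proj₁ (proj₁ (s ρ))

  y ∈dom ε = ⊥
  y ∈dom (h ▷ x ∶ φ [ fr , s ]) = (y ≡ x) ⊎ (y ∈dom h)

  data Expr where
    con : C → Expr ε
    wk  : ∀ {h y φ fr s} (t : Expr h) → (Vb t y → ⊥ {ℓ}) → Expr (h ▷ y ∶ φ [ fr , s ])
    var : ∀ {h y φ fr s} → Expr (h ▷ y ∶ φ [ fr , s ])
    app : ∀ {k m} (φ : Expr k) (φs : Fin m → Expr k) →
          (∀ σ → IsFunAt (⟦ φ ⟧ σ) (tabulate (λ i → ⟦ φs i ⟧ σ))) → Expr k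
    op  : ∀ {k} (f : F) {m} (φs : Fin m → Expr k) →
          (∀ σ → A f (tabulate (λ i → ⟦ φs i ⟧ σ))) → Expr k
    set : ∀ {k} (t : Tel k) → NonEmpty t → (φ : Expr (k ⊕ t)) → Expr k

  data Tel where
    [] : ∀ {k} → Tel k
    cons : ∀ {k} (y : V) (φ : Expr k) (fr : (y ∈dom k) → ⊥ {ℓ})
           (s : ∀ ρ → IsSet (⟦ φ ⟧ ρ)) → Tel (k ▷ y ∶ φ [ fr , s ]) → Tel k

  k ⊕ [] = k
  k ⊕ cons y φ fr s t = (k ▷ y ∶ φ [ fr , s ]) ⊕ t

  NonEmpty [] = ⊥
  NonEmpty (cons _ _ _ _ _) = ⊤

  Ext [] σ = ⊤
  Ext (cons y φ fr s t) σ = Σ (proj₁ (proj₁ (s σ))) λ i → Ext t (σ , i)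

  extend [] σ _ = σ
  extend (cons y φ fr s t) σ (i , e) = extend t (σ , i) e

  binders [] z = ⊥
  binders (cons y φ fr s t) z = (z ≡ y) ⊎ binders t z

  TelVb [] z = ⊥
  TelVb (cons y φ fr s t) z = Vb φ z ⊎ TelVb t z

  TelVf [] z = ⊥
  TelVf (cons y φ fr s t) z = Vf φ z ⊎ (TelVf t z × (z ≢ y))

  ⟦ con c ⟧ σ = #c c
  ⟦ wk t _ ⟧ (ρ , i) = ⟦ t ⟧ ρ
  ⟦ var {s = s} ⟧ (ρ , i) = proj₂ (proj₁ (s ρ)) i
  ⟦ app φ φs d ⟧ σ = apply (⟦ φ ⟧ σ) (tabulate (λ i → ⟦ φs i ⟧ σ)) (d σ)
  ⟦ op f φs a ⟧ σ = P f (tabulate (λ i → ⟦ φs i ⟧ σ)) (a σ)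
  ⟦ set t _ φ ⟧ σ = collect (Ext t σ) (λ e → ⟦ φ ⟧ (extend t σ e))

  Vb (con c) z = ⊥
  Vb (wk t _) z = Vb t z
  Vb var z = ⊥
  Vb (app {m = m} φ φs _) z = Vb φ z ⊎ Σ (Fin m) λ i → Vb (φs i) z
  Vb (op f {m} φs _) z = Σ (Fin m) λ i → Vb (φs i) z
  Vb (set t _ φ) z = binders t z ⊎ (TelVb t z ⊎ Vb φ z)

  Vf (con c) z = ⊥
  Vf (wk t _) z = Vf t z
  Vf (var {y = y}) z = z ≡ y
  Vf (app {m = m} φ φs _) z = Vf φ z ⊎ Σ (Fin m) λ i → Vf (φs i) z
  Vf (op f {m} φs _) z = Σ (Fin m) λ i → Vf (φs i) z
  Vf (set t _ φ) z = TelVf t z ⊎ (Vf φ z × (binders t z → ⊥ {ℓ}))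

  IsSentenceIn : ∀ k → Expr k → Set ℓ
  IsSentenceIn k t = ∀ σ → IsTrue (⟦ t ⟧ σ) ⊎ IsFalse (⟦ t ⟧ σ)

  IsSentence : Expr ε → Set ℓ
  IsSentence = IsSentenceIn ε

  #_ : Expr ε → Obj
  # t = ⟦ t ⟧ _

module Deduction {ℓ : Level} (U : Universe ℓ) (L : Language U) where
  open Universe U
  open Syntax U L

  record Axiom : Set (lsuc (lsuc ℓ)) where
    field
      Ax       : Expr ε → Set (lsuc ℓ)
      Ax-sent  : ∀ φ → Ax φ → IsSentence φ
      Ax-true  : ∀ φ → Ax φ → IsTrue (# φ)

  record Rule : Set (lsuc (lsuc ℓ)) where
    field
      arity  : ℕ
      R      : (Fin arity → Expr ε) → Expr ε → Set (lsuc ℓ)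
      R-sent : ∀ ψs ψ → R ψs ψ → (∀ i → IsSentence (ψs i)) × IsSentence ψ
      R-sound : ∀ ψs ψ → R ψs ψ → (∀ i → IsTrue (# ψs i)) → IsTrue (# ψ)

  record DeductiveSystem : Set (lsuc (lsuc ℓ)) where
    field
      AxIdx   : Set (lsuc ℓ)
      axiom   : AxIdx → Axiom
      RuleIdx : Set (lsuc ℓ)
      rule    : RuleIdx → Rule

  module _ (D : DeductiveSystem) where
    open DeductiveSystem D

    InAxiom : Expr ε → Set (lsuc ℓ)
    InAxiom ψ = Σ AxIdx λ a → Axiom.Ax (axiom a) ψ

    ByRule : ∀ {m} → (Fin m → Expr ε) → Fin m → Set (lsuc ℓ)
    ByRule ψ j = Σ RuleIdx λ r →
      Σ (Fin (Rule.arity (rule r)) → Fin _) λ is →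
        (∀ l → toℕ (is l) ℕ.< toℕ j) × Rule.R (rule r) (λ l → ψ (is l)) (ψ j)

    record ProofOf (φ : Expr ε) : Set (lsuc (lsuc ℓ)) where
      field
        len   : ℕ
        ψ     : Fin (suc len) → Expr ε
        sent  : ∀ j → IsSentence (ψ j)
        first : InAxiom (ψ zero)
        later : ∀ (j : Fin len) → InAxiom (ψ (suc j)) ⊎ ByRule ψ (suc j)
        last  : ψ (fromℕ len) ≡ φ

module Submission where

-- The argument is semantic.  Every axiom consists of true sentences and every
-- rule preserves truth, so by strong induction along a proof sequence every
-- entry of the sequence is true; in particular the proved sentence is true
-- (soundness).  If both φ and (¬)(φ) had proofs, soundness would make φ true
-- and the meaning of (¬)(φ), which is the truth value "φ is false", true as
-- well, i.e. φ would be false.  A universe never has an object that is both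
-- true and false, a contradiction.

open import Level using (Level; lower)
open import Data.List using ([]; _∷_; length)
open import Data.Empty using (⊥)
open import Data.Fin using (Fin; zero; suc; fromℕ; _<_)
open import Data.Fin.Induction using (<-wellFounded)
open import Data.Product using (_,_; proj₁)
open import Data.Sum using (inj₁; inj₂)
open import Induction.WellFounded using (module All)
open import Relation.Binary.PropositionalEquality using (_≡_; _≢_; subst)
open import Defs

module Soundness {ℓ : Level} (U : Universe ℓ) (L : Language U)
                 (D : Deduction.DeductiveSystem U L) where
  open Universe U
  open Syntax U L
  open Deduction U L
  open DeductiveSystem D

  axiomTrue : ∀ {ψ} → InAxiom D ψ → IsTrue (# ψ)
  axiomTrue (a , ψ∈a) = Axiom.Ax-true (axiom a) _ ψ∈a

  module _ {φ : Expr ε} (p : ProofOf D φ) where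
    open ProofOf p

    entryTrueFromEarlier : ∀ j → (∀ {i} → i < j → IsTrue (# ψ i)) → IsTrue (# ψ j)
    entryTrueFromEarlier zero    _       = axiomTrue first
    entryTrueFromEarlier (suc j) earlier with later j
    ... | inj₁ inAxiom = axiomTrue inAxiom
    ... | inj₂ (r , premises , premises<j , instance-of-r) =
      Rule.R-sound (rule r) _ _ instance-of-r (λ l → earlier (premises<j l))

    entryTrue : ∀ j → IsTrue (# ψ j)
    entryTrue = All.wfRec <-wellFounded ℓ (λ j → IsTrue (# ψ j)) entryTrueFromEarlier

  soundness : ∀ {φ} → ProofOf D φ → IsTrue (# φ)
  soundness p = subst (λ t → IsTrue (# t)) (ProofOf.last p)
                      (entryTrue p (fromℕ (ProofOf.len p)))

trueNegationFalseArgument : ∀ {ℓ : Level} (U : Universe ℓ) (L : Language U)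
  (¬sym : Language.F L) →
  (∀ x a → Language.P L ¬sym (x ∷ []) a ≡ Universe.⌜_⌝ U (Universe.IsFalse U x)) →
  ∀ x a → Universe.IsTrue U (Language.P L ¬sym (x ∷ []) a) → Universe.IsFalse U x
trueNegationFalseArgument U L ¬sym ¬-meaning x a ¬x-true =
  proj₁ (⌜⌝-true (IsFalse x)) (subst IsTrue (¬-meaning x a) ¬x-true)
  where open Universe U

mainTheorem2 : ∀ {ℓ : Level} (U : Universe ℓ) (L : Language U) (¬sym : Language.F L) →
    (∀ x → Language.A L ¬sym (x ∷ [])) →
    (∀ xs → length xs ≢ 1 → Language.A L ¬sym xs → ⊥) →
    (∀ x a → Language.P L ¬sym (x ∷ []) a ≡ Universe.⌜_⌝ U (Universe.IsFalse U x)) →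
    (D : Deduction.DeductiveSystem U L) →
    (φ : Syntax.Expr U L Syntax.ε) → Syntax.IsSentence U L φ →
    Deduction.ProofOf U L D φ →
    (a : ∀ σ → Language.A L ¬sym (Syntax.⟦_⟧ U L φ σ ∷ [])) →
    Deduction.ProofOf U L D (Syntax.op ¬sym (λ _ → φ) a) → ⊥
mainTheorem2 U L ¬sym _ _ ¬-meaning D φ _ proofOfφ a proofOf¬φ =
  lower (Universe.true-not-false U (# φ) φ-true φ-false)
  where
  open Universe U using (IsTrue; IsFalse)
  open Syntax U L using (#_)
  open Soundness U L D using (soundness)

  φ-true : IsTrue (# φ)
  φ-true = soundness proofOfφ

  -- the meaning of (¬)(φ) is P_¬ applied to the one-term sequence (#φ)
  φ-false : IsFalse (# φ)
  φ-false = trueNegationFalseArgument U L ¬sym ¬-meaning (# φ) _ (soundness proofOf¬φ)
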